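{- For every even positive integer $n$, $$2^{\frac n2}\binom{n}{n/2}^{ -1}M(n,4)\le RP\!\left(\frac n2\right)\le M(n,4).$$
   Context: Two permutations $\pi_1,\pi_2$ of $[m]$ are reversing if there exist coordinates $1\le i<j\le m$ with $\pi_1(i)=\pi_2(j)$ and $\pi_1(j)=\pi_2(i)$; $RP(m)$ is the maximum number of pairwise reversing permutations of $[m]$. Two perfect matchings on the same vertex set are $C_4$-creating if their union contains a cycle of length $4$; $M(n,4)$ is the maximum number of pairwise $C_4$-creating perfect matchings of the complete graph $K_n$. -}

module Defs where

open import Data.Nat using (ℕ; _≤_)
open import Data.Fin using (Fin; _<_)
open import Data.Fin.Permutation using (Permutation′; _⟨$⟩ʳ_)
open import Data.Product using (Σ; ∃; _×_)
open import Data.Sum using (_⊎_)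
open import Relation.Binary.PropositionalEquality using (_≡_; _≢_)

PairwiseFamily : {A : Set} → (A → A → Set) → ℕ → Set
PairwiseFamily {A} R k = Σ (Fin k → A) λ f → ∀ a b → a ≢ b → R (f a) (f b)

IsMaxPairwise : {A : Set} → (A → A → Set) → ℕ → Set
IsMaxPairwise R k = PairwiseFamily R k × (∀ l → PairwiseFamily R l → l ≤ k)

Reversing : {m : ℕ} → Permutation′ m → Permutation′ m → Set
Reversing {m} π₁ π₂ = Σ (Fin m) λ i → Σ (Fin m) λ j →
  i < j × (π₁ ⟨$⟩ʳ i ≡ π₂ ⟨$⟩ʳ j) × (π₁ ⟨$⟩ʳ j ≡ π₂ ⟨$⟩ʳ i)

IsRP : ℕ → ℕ → Set
IsRP m r = IsMaxPairwise (Reversing {m}) r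

-- A perfect matching of K_n on vertex set Fin n, given by the partner map:
-- a fixed-point-free involution (vertex x is matched to partner x).
record PerfectMatching (n : ℕ) : Set where
  field
    partner : Fin n → Fin n
    involutive : ∀ x → partner (partner x) ≡ x
    noFixed : ∀ x → partner x ≢ x
open PerfectMatching public

UnionAdj : {n : ℕ} → PerfectMatching n → PerfectMatching n → Fin n → Fin n → Set
UnionAdj M₁ M₂ x y = (partner M₁ x ≡ y) ⊎ (partner M₂ x ≡ y)

C4Creating : {n : ℕ} → PerfectMatching n → PerfectMatching n → Set
C4Creating {n} M₁ M₂ = Σ (Fin n) λ a → Σ (Fin n) λ b → Σ (Fin n) λ c → Σ (Fin n) λ d →
  (a ≢ b) × (a ≢ c) × (a ≢ d) × (b ≢ c) × (b ≢ d) × (c ≢ d) ×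
  UnionAdj M₁ M₂ a b × UnionAdj M₁ M₂ b c × UnionAdj M₁ M₂ c d × UnionAdj M₁ M₂ d a

IsM4 : ℕ → ℕ → Set
IsM4 n k = IsMaxPairwise (C4Creating {n}) k

-- A permutation π of [m] gives the bipartite matching {i, m + π i} of K_2m, and a reversal of
-- π₁, π₂ at coordinates i < j is the 4-cycle i, m + π₁ i, j, m + π₁ j in the union of their
-- matchings; hence RP(m) ≤ M(2m, 4).
-- For the other bound, double count pairs (M, S) of a matching M from a pairwise C4-creating
-- family of size k and a set S crossed by M (every edge of M has exactly one endpoint in S).
-- Each M crosses 2 ^ m sets, all of size m. Conversely, once S and its complement are indexed
-- by [m], every matching crossing S becomes a permutation of [m], and a 4-cycle in the union of
-- two of them has two opposite corners in S, which gives a reversal. So at most RP(m) matchings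
-- cross each of the C(2m, m) sets of size m.

module Submission where

open import Defs
open import Data.Nat using (ℕ; _+_; _*_; _^_; _≤_; _<_)
open import Data.Nat.Combinatorics using (_C_)
open import Data.Product using (_×_)

open import Algebra.Properties.CommutativeMonoid.Sum as Sum using ()
open import Algebra.Properties.Semiring.Sum as SemiringSum using ()
open import Data.Bool using (Bool; true; false; not; T; if_then_else_)
open import Data.Bool.Properties using (T-irrelevant; not-involutive; not-injective) renaming (_≟_ to _≟ᵇ_)
open import Data.Empty using (⊥-elim)
open import Data.Fin using (Fin; zero; suc; _<?_; _↑ˡ_; _↑ʳ_; splitAt; join; combine; finToFun; funToFin)
open import Data.Fin.Patterns using (0F; 1F)
open import Data.Fin.Permutation using (Permutation′; permutation; _⟨$⟩ʳ_; _⟨$⟩ˡ_; inverseˡ; inverseʳ)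
open import Data.Fin.Properties
  using (all?; <-cmp; <-asym; <-irrefl; injective⇒≤; splitAt-join; join-splitAt; remQuot-combine;
         finToFun-funToFin; funToFin-finToFin; 2↔Bool)
open import Data.Nat using (zero; suc; _≡ᵇ_; ⌊_/2⌋; z≤n)
open import Data.Nat.Combinatorics using (nCk+nC[k+1]≡[n+1]C[k+1])
open import Data.Nat.Properties
  using (+-mono-≤; +-suc; +-assoc; +-comm; +-identityʳ; *-zeroʳ; *-identityʳ; *-comm; +-cancelˡ-≡; ≤-antisym;
         n≡⌊n+n/2⌋; ≡ᵇ⇒≡; ≡⇒≡ᵇ; +-0-commutativeMonoid; +-*-semiring; module ≤-Reasoning)
open import Data.Product using (∃-syntax; _,_; proj₁; proj₂)
open import Data.Sum using (_⊎_; inj₁; inj₂)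
open import Data.Sum.Properties using (inj₁-injective; inj₂-injective)
open import Data.Unit using (tt)
open import Function using (_∘_; Inverse; Injection)
open import Function.Definitions using (Injective)
open import Function.Properties.Inverse using (↔⇒↣)
open import Relation.Binary.Definitions using (tri<; tri≈; tri>)
open import Relation.Binary.PropositionalEquality
open import Relation.Nullary using (¬_; Dec; yes; no; does; contradiction)
open import Relation.Nullary.Decidable using (T?; map′; dec-true; dec-false; ⌊_⌋; fromWitness; toWitness)

open Sum +-0-commutativeMonoid using (sum-syntax; sum-cong-≗; ∑-comm)
open SemiringSum +-*-semiring using (*-distribˡ-sum)

∑-mono-≤ : ∀ {N} {f g : Fin N → ℕ} → (∀ x → f x ≤ g x) → ∑[ x < N ] f x ≤ ∑[ x < N ] g x
∑-mono-≤ {zero} f≤g = z≤n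
∑-mono-≤ {suc N} f≤g = +-mono-≤ (f≤g zero) (∑-mono-≤ (f≤g ∘ suc))

∑-const : ∀ N c → ∑[ x < N ] c ≡ N * c
∑-const zero c = refl
∑-const (suc N) c = cong (c +_) (∑-const N c)

∑-↑ : ∀ a b (f : Fin (a + b) → ℕ) →
  ∑[ x < a + b ] f x ≡ ∑[ i < a ] f (i ↑ˡ b) + ∑[ j < b ] f (a ↑ʳ j)
∑-↑ zero b f = refl
∑-↑ (suc a) b f = trans (cong (f zero +_) (∑-↑ a b (f ∘ suc))) (sym (+-assoc (f zero) _ _))

∑-combine : ∀ m n (f : Fin (m * n) → ℕ) →
  ∑[ x < m * n ] f x ≡ ∑[ i < m ] ∑[ j < n ] f (combine i j)
∑-combine zero n f = refl
∑-combine (suc m) n f =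
  trans (∑-↑ n (m * n) f) (cong (∑[ j < n ] f (j ↑ˡ m * n) +_) (∑-combine m n (f ∘ (n ↑ʳ_))))

𝟙 : Bool → ℕ
𝟙 true = 1
𝟙 false = 0

count : ∀ {N} → (Fin N → Bool) → ℕ
count {N} p = ∑[ x < N ] 𝟙 (p x)

count-cong : ∀ {N} {p q : Fin N → Bool} → (∀ x → p x ≡ q x) → count p ≡ count q
count-cong p≗q = sum-cong-≗ (cong 𝟙 ∘ p≗q)

count+count-not : ∀ {N} (p : Fin N → Bool) → count p + count (not ∘ p) ≡ N
count+count-not {zero} p = refl
count+count-not {suc N} p with p zero
... | true = cong suc (count+count-not (p ∘ suc))
... | false = trans (+-suc _ _) (cong suc (count+count-not (p ∘ suc)))

count-none : ∀ {N} {p : Fin N → Bool} → (∀ x → ¬ T (p x)) → count p ≡ 0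
count-none {zero} _ = refl
count-none {suc N} {p} ¬p with p zero | ¬p zero
... | true | ¬p₀ = contradiction tt ¬p₀
... | false | _ = count-none (¬p ∘ suc)

record Enumeration {N : ℕ} (p : Fin N → Bool) (c : ℕ) : Set where
  field
    element : Fin c → Fin N
    element-∈ : ∀ i → T (p (element i))
    index : ∀ x → T (p x) → Fin c
    element-index : ∀ x px → element (index x px) ≡ x
    index-element : ∀ i pi → index (element i) pi ≡ i

  index-cong : ∀ {x y} → x ≡ y → (px : T (p x)) (py : T (p y)) → index x px ≡ index y py
  index-cong refl px py = cong (index _) (T-irrelevant px py)

  index-injective : ∀ {x y} (px : T (p x)) (py : T (p y)) → index x px ≡ index y py → x ≡ y
  index-injective {x} {y} px py eq =
    trans (sym (element-index x px)) (trans (cong element eq) (element-index y py))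

  element-injective : Injective _≡_ _≡_ element
  element-injective {i} {j} eq =
    trans (sym (index-element i (element-∈ i)))
      (trans (index-cong eq (element-∈ i) (element-∈ j)) (index-element j (element-∈ j)))

enumerate : ∀ {N} (p : Fin N → Bool) → Enumeration p (count p)
enumerate {zero} p = record
  { element = λ () ; element-∈ = λ () ; index = λ () ; element-index = λ () ; index-element = λ () }
enumerate {suc N} p with p zero in p₀ | enumerate (p ∘ suc)
... | true | E = record
  { element = λ { zero → zero ; (suc i) → suc (element i) }
  ; element-∈ = λ { zero → subst T (sym p₀) tt ; (suc i) → element-∈ i }
  ; index = λ { zero _ → zero ; (suc x) px → suc (index x px) }
  ; element-index = λ { zero _ → refl ; (suc x) px → cong suc (element-index x px) }
  ; index-element = λ { zero _ → refl ; (suc i) pi → cong suc (index-element i pi) }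
  } where open Enumeration E
... | false | E = record
  { element = suc ∘ element
  ; element-∈ = element-∈
  ; index = λ { zero p0 → ⊥-elim (subst T p₀ p0) ; (suc x) px → index x px }
  ; element-index = λ { zero p0 → ⊥-elim (subst T p₀ p0) ; (suc x) px → cong suc (element-index x px) }
  ; index-element = index-element
  } where open Enumeration E

injection⇒≤count : ∀ {a N} (p : Fin N → Bool) (g : Fin a → Fin N) →
  (∀ i → T (p (g i))) → Injective _≡_ _≡_ g → a ≤ count p
injection⇒≤count p g g∈p g-injective =
  injective⇒≤ (λ {i} {j} eq → g-injective (index-injective (g∈p i) (g∈p j) eq))
  where open Enumeration (enumerate p)

module _ {N : ℕ} {p : Fin N → Bool} {c : ℕ} (E : Enumeration p c) where
  open Enumeration E

  extend : (Fin c → Bool) → Fin N → Bool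
  extend w x with T? (p x)
  ... | yes px = w (index x px)
  ... | no _ = false

  extend-element : ∀ w i → extend w (element i) ≡ w i
  extend-element w i with T? (p (element i))
  ... | yes px = cong w (index-element i px)
  ... | no ¬px = contradiction (element-∈ i) ¬px

-- Subsets of Fin n, indexed by Fin (2 ^ n)

open Inverse 2↔Bool using (strictlyInverseˡ; strictlyInverseʳ)
  renaming (to to toBool; from to fromBool)

subset : ∀ {n} → Fin (2 ^ n) → Fin n → Bool
subset {n} u = toBool ∘ finToFun {2} {n} u

code : ∀ {n} → (Fin n → Bool) → Fin (2 ^ n)
code s = funToFin (fromBool ∘ s)

subset-code : ∀ {n} (s : Fin n → Bool) x → subset (code s) x ≡ s x
subset-code s x = trans (cong toBool (finToFun-funToFin (fromBool ∘ s) x)) (strictlyInverseˡ (s x))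

funToFin-cong : ∀ {m n} {f g : Fin m → Fin n} → (∀ x → f x ≡ g x) → funToFin f ≡ funToFin g
funToFin-cong {zero} f≗g = refl
funToFin-cong {suc m} f≗g = cong₂ combine (f≗g zero) (funToFin-cong (f≗g ∘ suc))

subset-injective : ∀ {n} {u v : Fin (2 ^ n)} → (∀ x → subset u x ≡ subset v x) → u ≡ v
subset-injective {n} {u} {v} u≗v = begin
  u                               ≡⟨ funToFin-finToFin {n} u ⟨
  funToFin (finToFun {2} {n} u)   ≡⟨ funToFin-cong finToFun-u≗v ⟩
  funToFin (finToFun {2} {n} v)   ≡⟨ funToFin-finToFin {n} v ⟩
  v                               ∎
  where
  open ≡-Reasoning
  finToFun-u≗v : ∀ x → finToFun {2} {n} u x ≡ finToFun v x
  finToFun-u≗v x = trans (sym (strictlyInverseʳ _)) (trans (cong fromBool (u≗v x)) (strictlyInverseʳ _))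

count-subset-combine : ∀ {n} (i : Fin 2) (u : Fin (2 ^ n)) →
  count (subset {suc n} (combine i u)) ≡ 𝟙 (toBool i) + count (subset {n} u)
count-subset-combine {n} i u = cong₂ _+_
  (cong (𝟙 ∘ toBool ∘ proj₁) (remQuot-combine i u))
  (count-cong λ x → cong (λ w → toBool (finToFun {2} {n} (proj₂ w) x)) (remQuot-combine i u))

#subsets-of-size : ∀ n k → ∑[ u < 2 ^ n ] 𝟙 (count (subset {n} u) ≡ᵇ k) ≡ n C k
#subsets-of-size zero zero = refl
#subsets-of-size zero (suc k) = refl
#subsets-of-size (suc n) k = begin
  ∑[ u < 2 * 2 ^ n ] 𝟙 (count (subset {suc n} u) ≡ᵇ k)
    ≡⟨ ∑-combine 2 (2 ^ n) _ ⟩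
  ∑[ u < 2 ^ n ] sized 0F u + (∑[ u < 2 ^ n ] sized 1F u + 0)
    ≡⟨ cong₂ _+_ (sum-cong-≗ (sized-combine 0F)) (trans (+-identityʳ _) (sum-cong-≗ (sized-combine 1F))) ⟩
  ∑[ u < 2 ^ n ] 𝟙 (count (subset {n} u) ≡ᵇ k) + ∑[ u < 2 ^ n ] 𝟙 (suc (count (subset {n} u)) ≡ᵇ k)
    ≡⟨ pascal k ⟩
  suc n C k ∎
  where
  open ≡-Reasoning
  sized : Fin 2 → Fin (2 ^ n) → ℕ
  sized i u = 𝟙 (count (subset {suc n} (combine i u)) ≡ᵇ k)
  sized-combine : ∀ i u → sized i u ≡ 𝟙 (𝟙 (toBool i) + count (subset {n} u) ≡ᵇ k)
  sized-combine i u = cong (λ c → 𝟙 (c ≡ᵇ k)) (count-subset-combine {n} i u)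
  pascal : ∀ k → ∑[ u < 2 ^ n ] 𝟙 (count (subset {n} u) ≡ᵇ k)
                 + ∑[ u < 2 ^ n ] 𝟙 (suc (count (subset {n} u)) ≡ᵇ k) ≡ suc n C k
  pascal zero = cong₂ _+_ (#subsets-of-size n zero) (trans (∑-const (2 ^ n) 0) (*-zeroʳ (2 ^ n)))
  pascal (suc k) = trans (cong₂ _+_ (#subsets-of-size n (suc k)) (#subsets-of-size n k))
                         (trans (+-comm (n C suc k) (n C k)) (nCk+nC[k+1]≡[n+1]C[k+1] n k))

-- Perfect matchings and the sets they cross

module _ {n : ℕ} (M : PerfectMatching n) where

  partner-injective : Injective _≡_ _≡_ (partner M)
  partner-injective {x} {y} eq =
    trans (sym (involutive M x)) (trans (cong (partner M) eq) (involutive M y))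

  partner-flip : ∀ {x y} → partner M x ≡ y → partner M y ≡ x
  partner-flip refl = involutive M _

  partner-twice : ∀ {x y z} → partner M x ≡ y → partner M y ≡ z → x ≡ z
  partner-twice refl refl = sym (involutive M _)

record Crossing {n : ℕ} (M : PerfectMatching n) (s : Fin n → Bool) : Set where
  constructor crossing
  field flips : ∀ x → s (partner M x) ≡ not (s x)
open Crossing public

crossing? : ∀ {n} (M : PerfectMatching n) (s : Fin n → Bool) → Dec (Crossing M s)
crossing? M s = map′ crossing flips (all? λ x → s (partner M x) ≟ᵇ not (s x))

module _ {n : ℕ} {M : PerfectMatching n} {s : Fin n → Bool} (M-crosses-s : Crossing M s) where

  partner-∉ : ∀ {x} → T (s x) → T (not (s (partner M x)))
  partner-∉ {x} sx rewrite flips M-crosses-s x | not-involutive (s x) = sx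

  partner-∈ : ∀ {x} → T (not (s x)) → T (s (partner M x))
  partner-∈ {x} ¬sx rewrite flips M-crosses-s x = ¬sx

  crossing-not : Crossing M (not ∘ s)
  crossing-not = crossing λ x → cong not (flips M-crosses-s x)

  count≤count-not : count s ≤ count (not ∘ s)
  count≤count-not = injection⇒≤count (not ∘ s) (partner M ∘ element) (partner-∉ ∘ element-∈)
    (element-injective ∘ partner-injective M)
    where open Enumeration (enumerate s)

count-crossing : ∀ {n} {M : PerfectMatching n} {s : Fin n → Bool} → Crossing M s → count s + count s ≡ n
count-crossing {s = s} c = trans (cong (count s +_) count-s≡count-not-s) (count+count-not s)
  where
  count-s≡count-not-s : count s ≡ count (not ∘ s)
  count-s≡count-not-s = ≤-antisym (count≤count-not c)
    (subst (count (not ∘ s) ≤_) (count-cong (not-involutive ∘ s))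
      (count≤count-not (crossing-not c)))

count-crossing-half : ∀ {m} {M : PerfectMatching (m + m)} {s} → Crossing M s → count s ≡ m
count-crossing-half {m} {s = s} c =
  trans (n≡⌊n+n/2⌋ (count s)) (trans (cong ⌊_/2⌋ (count-crossing c)) (sym (n≡⌊n+n/2⌋ m)))

crosses : ∀ {n} → PerfectMatching n → (Fin n → Bool) → Bool
crosses M s = ⌊ crossing? M s ⌋

<?-flip : ∀ {n} {x y : Fin n} → x ≢ y → does (y <? x) ≡ not (does (x <? y))
<?-flip {x = x} {y} x≢y with <-cmp x y
... | tri< x<y _ _ = trans (dec-false (y <? x) (<-asym x<y)) (cong not (sym (dec-true (x <? y) x<y)))
... | tri≈ _ x≡y _ = contradiction x≡y x≢y
... | tri> _ _ y<x = trans (dec-true (y <? x) y<x) (cong not (sym (dec-false (x <? y) (<-asym y<x))))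

-- A set crossed by M is determined by its trace on the lower endpoints of the edges of M, and
-- every trace extends to such a set; so M crosses at least 2 ^ m sets.
module _ {m : ℕ} (M : PerfectMatching (m + m)) where

  lowerEnd : Fin (m + m) → Bool
  lowerEnd x = does (x <? partner M x)

  lowerEnd-crossing : Crossing M lowerEnd
  lowerEnd-crossing = crossing λ x →
    trans (cong (λ y → does (partner M x <? y)) (involutive M x)) (<?-flip (noFixed M x ∘ sym))

  lowerEnds : Enumeration lowerEnd m
  lowerEnds = subst (Enumeration lowerEnd) (count-crossing-half lowerEnd-crossing) (enumerate lowerEnd)

  crossingExtension : (Fin (m + m) → Bool) → Fin (m + m) → Bool
  crossingExtension b x = if lowerEnd x then b x else not (b (partner M x))

  crossingExtension-crossing : ∀ b → Crossing M (crossingExtension b)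
  crossingExtension-crossing b = crossing flip
    where
    flip : ∀ x → crossingExtension b (partner M x) ≡ not (crossingExtension b x)
    flip x rewrite flips lowerEnd-crossing x | involutive M x with lowerEnd x
    ... | true = refl
    ... | false = sym (not-involutive _)

  crossingExtension-lowerEnd : ∀ b {x} → T (lowerEnd x) → crossingExtension b x ≡ b x
  crossingExtension-lowerEnd b {x} _ with lowerEnd x
  ... | true = refl

  open Enumeration lowerEnds using (element; element-∈)

  crossingSubset : Fin (2 ^ m) → Fin (m + m) → Bool
  crossingSubset w = crossingExtension (extend lowerEnds (subset w))

  crossingSubset-crossing : ∀ w → Crossing M (crossingSubset w)
  crossingSubset-crossing w = crossingExtension-crossing (extend lowerEnds (subset w))

  crossingSubset-element : ∀ w i → crossingSubset w (element i) ≡ subset w i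
  crossingSubset-element w i =
    trans (crossingExtension-lowerEnd (extend lowerEnds (subset w)) (element-∈ i))
      (extend-element lowerEnds (subset w) i)

  crossingCode : Fin (2 ^ m) → Fin (2 ^ (m + m))
  crossingCode w = code (crossingSubset w)

  crossingCode-injective : Injective _≡_ _≡_ crossingCode
  crossingCode-injective {v} {w} eq = subset-injective λ i → begin
    subset v i                           ≡⟨ crossingSubset-element v i ⟨
    crossingSubset v (element i)         ≡⟨ subset-code (crossingSubset v) (element i) ⟨
    subset (crossingCode v) (element i)  ≡⟨ cong (λ u → subset u (element i)) eq ⟩
    subset (crossingCode w) (element i)  ≡⟨ subset-code (crossingSubset w) (element i) ⟩
    crossingSubset w (element i)         ≡⟨ crossingSubset-element w i ⟩
    subset w i                           ∎
    where open ≡-Reasoning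

  crossingCode-crosses : ∀ w → T (crosses M (subset (crossingCode w)))
  crossingCode-crosses w = fromWitness (crossing λ x → begin
    subset (crossingCode w) (partner M x)  ≡⟨ subset-code (crossingSubset w) (partner M x) ⟩
    crossingSubset w (partner M x)         ≡⟨ flips (crossingSubset-crossing w) x ⟩
    not (crossingSubset w x)               ≡⟨ cong not (subset-code (crossingSubset w) x) ⟨
    not (subset (crossingCode w) x)        ∎)
    where open ≡-Reasoning

  2^m≤#crossingSets : 2 ^ m ≤ count (λ u → crosses M (subset u))
  2^m≤#crossingSets = injection⇒≤count _ crossingCode crossingCode-crosses crossingCode-injective

-- Matchings crossing a common set as permutations

reversingAt : ∀ {m} {π₁ π₂ : Permutation′ m} {i j} → i ≢ j →
  π₁ ⟨$⟩ʳ i ≡ π₂ ⟨$⟩ʳ j → π₁ ⟨$⟩ʳ j ≡ π₂ ⟨$⟩ʳ i → Reversing π₁ π₂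
reversingAt {i = i} {j} i≢j eqᵢ eqⱼ with <-cmp i j
... | tri< i<j _ _ = i , j , i<j , eqᵢ , eqⱼ
... | tri≈ _ i≡j _ = contradiction i≡j i≢j
... | tri> _ _ j<i = j , i , j<i , eqⱼ , eqᵢ

module _ {n : ℕ} (M₁ M₂ : PerfectMatching n) where

  Swapped : Fin n → Fin n → Set
  Swapped x y = partner M₁ x ≡ partner M₂ y × partner M₁ y ≡ partner M₂ x

  -- Consecutive edges of the 4-cycle lie in different matchings, so its opposite corners a and c
  -- have swapped partners.
  C4⇒swapped : C4Creating M₁ M₂ → ∃[ x ] ∃[ y ] x ≢ y × Swapped x y
  C4⇒swapped (a , b , c , d , _ , a≢c , _ , _ , b≢d , _ , ab , bc , cd , da) =
    a , c , a≢c , alternate ab bc cd da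
    where
    alternate : UnionAdj M₁ M₂ a b → UnionAdj M₁ M₂ b c → UnionAdj M₁ M₂ c d → UnionAdj M₁ M₂ d a →
                Swapped a c
    alternate (inj₁ ab) (inj₁ bc) _ _ = contradiction (partner-twice M₁ ab bc) a≢c
    alternate (inj₂ ab) (inj₂ bc) _ _ = contradiction (partner-twice M₂ ab bc) a≢c
    alternate (inj₁ _) (inj₂ bc) (inj₂ cd) _ = contradiction (partner-twice M₂ bc cd) b≢d
    alternate (inj₂ _) (inj₁ bc) (inj₁ cd) _ = contradiction (partner-twice M₁ bc cd) b≢d
    alternate (inj₁ _) (inj₂ _) (inj₁ cd) (inj₁ da) = contradiction (sym (partner-twice M₁ cd da)) a≢c
    alternate (inj₂ _) (inj₁ _) (inj₂ cd) (inj₂ da) = contradiction (sym (partner-twice M₂ cd da)) a≢c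
    alternate (inj₁ ab) (inj₂ bc) (inj₁ cd) (inj₂ da) =
      trans ab (sym (partner-flip M₂ bc)) , trans cd (sym (partner-flip M₂ da))
    alternate (inj₂ ab) (inj₁ bc) (inj₂ cd) (inj₁ da) =
      trans (partner-flip M₁ da) (sym cd) , trans (partner-flip M₁ bc) (sym ab)

  swapped-partner : ∀ {x y} → Swapped x y → Swapped (partner M₁ x) (partner M₁ y)
  swapped-partner {x} {y} (xy , yx) =
      trans (involutive M₁ x) (sym (trans (cong (partner M₂) yx) (involutive M₂ x)))
    , trans (involutive M₁ y) (sym (trans (cong (partner M₂) xy) (involutive M₂ y)))

  swapped-sameSide : ∀ {s x y} → Crossing M₁ s → Crossing M₂ s → Swapped x y → s y ≡ s x
  swapped-sameSide {s} {x} {y} c₁ c₂ (_ , yx) =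
    not-injective (trans (sym (flips c₁ y)) (trans (cong s yx) (flips c₂ x)))

  swapped-inside : ∀ {s x y} → Crossing M₁ s → Crossing M₂ s → x ≢ y → Swapped x y →
    ∃[ x′ ] ∃[ y′ ] x′ ≢ y′ × T (s x′) × T (s y′) × Swapped x′ y′
  swapped-inside {s} {x} {y} c₁ c₂ x≢y sw with s x in sx
  ... | true = x , y , x≢y , subst T (sym sx) tt
             , subst T (sym (trans (swapped-sameSide c₁ c₂ sw) sx)) tt , sw
  ... | false = partner M₁ x , partner M₁ y , x≢y ∘ partner-injective M₁ , inside x sx
    , inside y (trans (swapped-sameSide c₁ c₂ sw) sx) , swapped-partner sw
    where
    inside : ∀ z → s z ≡ false → T (s (partner M₁ z))
    inside z sz = subst T (sym (trans (flips c₁ z) (cong not sz))) tt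

module _ {n m : ℕ} {s : Fin n → Bool} (A : Enumeration s m) (B : Enumeration (not ∘ s) m) where
  private
    module A = Enumeration A
    module B = Enumeration B

  permutationAcross : (M : PerfectMatching n) → Crossing M s → Permutation′ m
  permutationAcross M c = permutation to from to-from from-to
    where
    to : Fin m → Fin m
    to i = B.index (partner M (A.element i)) (partner-∉ c (A.element-∈ i))
    from : Fin m → Fin m
    from j = A.index (partner M (B.element j)) (partner-∈ c (B.element-∈ j))
    to-from : ∀ j → to (from j) ≡ j
    to-from j = trans (B.index-cong (partner-flip M (sym (A.element-index _ _))) _ (B.element-∈ j))
                      (B.index-element j _)
    from-to : ∀ i → from (to i) ≡ i
    from-to i = trans (A.index-cong (partner-flip M (sym (B.element-index _ _))) _ (A.element-∈ i))
                      (A.index-element i _)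

  permutationAcross-index : ∀ M (c : Crossing M s) {x} (sx : T (s x)) →
    permutationAcross M c ⟨$⟩ʳ A.index x sx ≡ B.index (partner M x) (partner-∉ c sx)
  permutationAcross-index M c sx = B.index-cong (cong (partner M) (A.element-index _ sx)) _ _

  swapped⇒reversing : ∀ {M₁ M₂} (c₁ : Crossing M₁ s) (c₂ : Crossing M₂ s) {x y} → x ≢ y →
    (sx : T (s x)) (sy : T (s y)) → Swapped M₁ M₂ x y →
    Reversing (permutationAcross M₁ c₁) (permutationAcross M₂ c₂)
  swapped⇒reversing {M₁} {M₂} c₁ c₂ x≢y sx sy (xy , yx) =
    reversingAt {π₁ = permutationAcross M₁ c₁} {permutationAcross M₂ c₂} {A.index _ sx} {A.index _ sy}
      (x≢y ∘ A.index-injective sx sy) (opposite sx sy xy) (opposite sy sx yx)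
    where
    opposite : ∀ {x y} (sx : T (s x)) (sy : T (s y)) → partner M₁ x ≡ partner M₂ y →
      permutationAcross M₁ c₁ ⟨$⟩ʳ A.index x sx ≡ permutationAcross M₂ c₂ ⟨$⟩ʳ A.index y sy
    opposite sx sy xy = trans (permutationAcross-index M₁ c₁ sx)
      (trans (B.index-cong xy _ _) (sym (permutationAcross-index M₂ c₂ sy)))

module _ {m k r : ℕ} (rp : IsRP m r) (F : Fin k → PerfectMatching (m + m))
         (F-pairwise : ∀ a b → a ≢ b → C4Creating (F a) (F b)) where

  #crossingMatchings≤RP : ∀ {s} → count s ≡ m → count (λ t → crosses (F t) s) ≤ r
  #crossingMatchings≤RP {s} #s≡m = proj₂ rp _ (permutations , permutations-reversing)
    where
    #not-s≡m : count (not ∘ s) ≡ m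
    #not-s≡m = +-cancelˡ-≡ m _ _ (trans (cong (_+ count (not ∘ s)) (sym #s≡m)) (count+count-not s))
    inside : Enumeration s m
    inside = subst (Enumeration s) #s≡m (enumerate s)
    outside : Enumeration (not ∘ s) m
    outside = subst (Enumeration (not ∘ s)) #not-s≡m (enumerate (not ∘ s))
    open Enumeration (enumerate (λ t → crosses (F t) s))
    G : Fin (count (λ t → crosses (F t) s)) → PerfectMatching (m + m)
    G = F ∘ element
    G-crossing : ∀ i → Crossing (G i) s
    G-crossing i = toWitness (element-∈ i)
    permutations : Fin (count (λ t → crosses (F t) s)) → Permutation′ m
    permutations i = permutationAcross inside outside (G i) (G-crossing i)
    permutations-reversing : ∀ i j → i ≢ j → Reversing (permutations i) (permutations j)
    permutations-reversing i j i≢j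
      with x , y , x≢y , sw ← C4⇒swapped (G i) (G j) (F-pairwise _ _ (i≢j ∘ element-injective))
      with x′ , y′ , x′≢y′ , sx′ , sy′ , sw′ ← swapped-inside (G i) (G j) (G-crossing i) (G-crossing j) x≢y sw
      = swapped⇒reversing inside outside (G-crossing i) (G-crossing j) x′≢y′ sx′ sy′ sw′

  #crossingMatchings≤ : ∀ s → count (λ t → crosses (F t) s) ≤ r * 𝟙 (count s ≡ᵇ m)
  #crossingMatchings≤ s with count s ≡ᵇ m in #s≡ᵇm
  ... | true = subst (count (λ t → crosses (F t) s) ≤_) (sym (*-identityʳ r))
                     (#crossingMatchings≤RP (≡ᵇ⇒≡ _ _ (subst T (sym #s≡ᵇm) tt)))
  ... | false = subst (_≤ r * 0) (sym (count-none none)) z≤n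
    where
    none : ∀ t → ¬ T (crosses (F t) s)
    none t ct = subst T #s≡ᵇm (≡⇒≡ᵇ _ _ (count-crossing-half {m} (toWitness ct)))

  doubleCounting : 2 ^ m * k ≤ r * ((m + m) C m)
  doubleCounting = begin
    2 ^ m * k                                      ≡⟨ *-comm (2 ^ m) k ⟩
    k * 2 ^ m                                      ≡⟨ ∑-const k (2 ^ m) ⟨
    ∑[ t < k ] (2 ^ m)                             ≤⟨ ∑-mono-≤ (2^m≤#crossingSets {m} ∘ F) ⟩
    ∑[ t < k ] ∑[ u < 2 ^ (m + m) ] incidence t u  ≡⟨ ∑-comm incidence ⟩
    ∑[ u < 2 ^ (m + m) ] ∑[ t < k ] incidence t u  ≤⟨ ∑-mono-≤ (#crossingMatchings≤ ∘ subset) ⟩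
    ∑[ u < 2 ^ (m + m) ] (r * hasSize-m u)         ≡⟨ *-distribˡ-sum r hasSize-m ⟨
    r * ∑[ u < 2 ^ (m + m) ] hasSize-m u           ≡⟨ cong (r *_) (#subsets-of-size (m + m) m) ⟩
    r * ((m + m) C m)                              ∎
    where
    open ≤-Reasoning
    incidence : Fin k → Fin (2 ^ (m + m)) → ℕ
    incidence t u = 𝟙 (crosses (F t) (subset u))
    hasSize-m : Fin (2 ^ (m + m)) → ℕ
    hasSize-m u = 𝟙 (count (subset {m + m} u) ≡ᵇ m)

-- Permutations as bipartite matchings

join-injective : ∀ {a b} {y y′ : Fin a ⊎ Fin b} → join a b y ≡ join a b y′ → y ≡ y′
join-injective {a} {b} {y} {y′} eq =
  trans (sym (splitAt-join a b y)) (trans (cong (splitAt a) eq) (splitAt-join a b y′))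

module _ {m : ℕ} (π : Permutation′ m) where

  swapSides : Fin m ⊎ Fin m → Fin m ⊎ Fin m
  swapSides (inj₁ i) = inj₂ (π ⟨$⟩ʳ i)
  swapSides (inj₂ j) = inj₁ (π ⟨$⟩ˡ j)

  swapSides-involutive : ∀ y → swapSides (swapSides y) ≡ y
  swapSides-involutive (inj₁ i) = cong inj₁ (inverseˡ π)
  swapSides-involutive (inj₂ j) = cong inj₂ (inverseʳ π)

  swapSides-noFixed : ∀ y → swapSides y ≢ y
  swapSides-noFixed (inj₁ _) ()
  swapSides-noFixed (inj₂ _) ()

  bipartitePartner : Fin (m + m) → Fin (m + m)
  bipartitePartner = join m m ∘ swapSides ∘ splitAt m

  bipartitePartner-join : ∀ y → bipartitePartner (join m m y) ≡ join m m (swapSides y)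
  bipartitePartner-join y = cong (join m m ∘ swapSides) (splitAt-join m m y)

  bipartiteMatching : PerfectMatching (m + m)
  bipartiteMatching = record
    { partner = bipartitePartner
    ; involutive = λ x → trans (bipartitePartner-join (swapSides (splitAt m x)))
                               (trans (cong (join m m) (swapSides-involutive (splitAt m x))) (join-splitAt m m x))
    ; noFixed = λ x eq → swapSides-noFixed (splitAt m x) (join-injective (trans eq (sym (join-splitAt m m x))))
    }

reversing⇒C4Creating : ∀ {m} {π₁ π₂ : Permutation′ m} → Reversing π₁ π₂ →
  C4Creating (bipartiteMatching π₁) (bipartiteMatching π₂)
reversing⇒C4Creating {m} {π₁} {π₂} (i , j , i<j , π₁i≡π₂j , π₁j≡π₂i) =
  left i , right (π₁ ⟨$⟩ʳ i) , left j , right (π₁ ⟨$⟩ʳ j) ,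
  left≢right , i≢j ∘ inj₁-injective ∘ join-injective , left≢right ,
  left≢right ∘ sym , i≢j ∘ Injection.injective (↔⇒↣ π₁) ∘ inj₂-injective ∘ join-injective ,
  left≢right ,
  inj₁ (bipartitePartner-join π₁ (inj₁ i)) , inj₂ (back π₁i≡π₂j) ,
  inj₁ (bipartitePartner-join π₁ (inj₁ j)) , inj₂ (back π₁j≡π₂i)
  where
  left right : Fin m → Fin (m + m)
  left i = join m m (inj₁ i)
  right j = join m m (inj₂ j)
  left≢right : ∀ {x y} → left x ≢ right y
  left≢right {x} {y} eq = contradiction (join-injective {m} {m} {inj₁ x} {inj₂ y} eq) λ ()
  i≢j : i ≢ j
  i≢j refl = <-irrefl refl i<j
  back : ∀ {x y} → π₁ ⟨$⟩ʳ x ≡ π₂ ⟨$⟩ʳ y → bipartitePartner π₂ (right (π₁ ⟨$⟩ʳ x)) ≡ left y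
  back eq = trans (bipartitePartner-join π₂ (inj₂ _))
    (trans (cong (left ∘ (π₂ ⟨$⟩ˡ_)) eq) (cong left (inverseˡ π₂)))

RP≤M4 : ∀ {m r k} → IsRP m r → IsM4 (m + m) k → r ≤ k
RP≤M4 ((π , π-reversing) , _) (_ , M4-maximal) =
  M4-maximal _ (bipartiteMatching ∘ π , λ a b a≢b → reversing⇒C4Creating (π-reversing a b a≢b))

claim4p2 : ∀ (m : ℕ) → 0 < m → ∀ (r k : ℕ) → IsRP m r → IsM4 (m + m) k →
    (2 ^ m * k ≤ r * ((m + m) C m)) × (r ≤ k)
claim4p2 m _ r k rp mk@((F , F-pairwise) , _) = doubleCounting rp F F-pairwise , RP≤M4 rp mk
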